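{- Let $(\mathcal{M},\sqsubseteq,d)$ be a metric subset space. Let $O_r\in\mathcal{M}$, $r(O_r)\geq 0$, and let $\mathcal{T}\subseteq\mathcal{M}$ be a set of objects such that every $O_j\in\mathcal{T}$ satisfies $O_r\sqsubseteq O_j$ and $d(O_r,O_j)\leq r(O_r)$. Let $Q\in\mathcal{M}$ and $r(Q)\geq 0$. If $d(O_r,Q) > r(Q)+r(O_r)$, then $d(O_j,Q) > r(Q)$ for every $O_j\in\mathcal{T}$ with $O_j\sqsubseteq Q$.
   Context: A total preorder on a set $\mathcal{M}$ is a reflexive, total and transitive relation. A metric subset space is a triple $(\mathcal{M},\sqsubseteq,d)$ with $\sqsubseteq$ a total preorder on $\mathcal{M}$ and $d:\mathcal{M}\times\mathcal{M}\to\mathbb{R}^{\geq 0}$ satisfying (S1) $d(x,z)\leq d(x,y)+d(y,z)$ for all $x,y,z$ with $x\sqsubseteq y\sqsubseteq z$, and (S2) $d(x,y)=0$ if and only if $x=y$. In the paper's index structure (SuperM-Tree), $O_r$ is a routing object with covering radius $r(O_r)$ and $\mathcal{T}$ is the set of objects in its covered subtree; the structure guarantees the two stated conditions on $\mathcal{T}$. -}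

module Defs where

open import Level using (Level; suc; _⊔_)
open import Relation.Binary.PropositionalEquality using (_≡_; _≢_)
open import Relation.Binary.Structures using (IsTotalOrder; IsTotalPreorder)
open import Data.Product using (_×_)
open import Relation.Nullary using (¬_)

-- Abstract stand-in for the value set of distances/radii (the paper uses ℝ,
-- with values in ℝ≥0).  The reals form an instance; any theorem proved for
-- all such structures therefore holds for ℝ.
record OrderedCommMonoid (a : Level) : Set (suc a) where
  infixl 6 _+_
  infix 4 _≤_ _<_
  field
    Val      : Set a
    _≤_      : Val → Val → Set a
    _+_      : Val → Val → Val
    0#       : Val
    isTotalOrder : IsTotalOrder _≡_ _≤_
    +-comm   : ∀ x y → x + y ≡ y + x
    +-assoc  : ∀ x y z → (x + y) + z ≡ x + (y + z)
    +-identityˡ : ∀ x → 0# + x ≡ x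
    +-mono-≤ : ∀ {x y u v} → x ≤ y → u ≤ v → x + u ≤ y + v

  _<_ : Val → Val → Set a
  x < y = (x ≤ y) × (x ≢ y)

record MetricSubsetSpace {a : Level} (V : OrderedCommMonoid a) (m ℓ : Level)
       : Set (suc (m ⊔ ℓ) ⊔ a) where
  open OrderedCommMonoid V
  field
    M   : Set m
    _⊑_ : M → M → Set ℓ
    isTotalPreorder : IsTotalPreorder _≡_ _⊑_
    d   : M → M → Val
    d-nonneg : ∀ x y → 0# ≤ d x y
    S1  : ∀ {x y z} → x ⊑ y → y ⊑ z → d x z ≤ d x y + d y z
    S2  : ∀ {x y} → (d x y ≡ 0# → x ≡ y) × (x ≡ y → d x y ≡ 0#)

module Submission where

-- Idea: suppose some covered object Oj ⊑ Q were within distance rQ of Q.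
-- Since Or ⊑ Oj ⊑ Q, the restricted triangle inequality (S1) gives
--   d Or Q ≤ d Or Oj + d Oj Q ≤ rOr + rQ,
-- contradicting rQ + rOr < d Or Q.  As the value order is total, the failure
-- of d Oj Q ≤ rQ means exactly rQ < d Oj Q.

open import Defs
open import Data.Product using (_×_; _,_)
open import Data.Sum using (inj₁; inj₂)
open import Data.Empty using (⊥-elim)
open import Relation.Nullary using (¬_)
open import Relation.Binary.PropositionalEquality using (sym; subst)
open import Relation.Binary.Structures using (IsTotalOrder)

module StrictOrder {a} (V : OrderedCommMonoid a) where
  open OrderedCommMonoid V
  open IsTotalOrder isTotalOrder using (total; antisym; reflexive)

  <⇒≱ : ∀ {x y} → x < y → ¬ (y ≤ x)
  <⇒≱ (x≤y , x≢y) y≤x = x≢y (antisym x≤y y≤x)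

  ≰⇒> : ∀ {x y} → ¬ (y ≤ x) → x < y
  ≰⇒> {x} {y} y≰x with total x y
  ... | inj₁ x≤y = x≤y , λ x≡y → y≰x (reflexive (sym x≡y))
  ... | inj₂ y≤x = ⊥-elim (y≰x y≤x)

module ChainBound {a m ℓ} {V : OrderedCommMonoid a}
                  (S : MetricSubsetSpace V m ℓ) where
  open OrderedCommMonoid V
  open MetricSubsetSpace S
  open IsTotalOrder isTotalOrder using (trans)

  ⊑-chain-bound : ∀ {x y z r s} → x ⊑ y → y ⊑ z → d x y ≤ r → d y z ≤ s →
                  d x z ≤ r + s
  ⊑-chain-bound x⊑y y⊑z dxy≤r dyz≤s = trans (S1 x⊑y y⊑z) (+-mono-≤ dxy≤r dyz≤s)

lemma1 : ∀ {a m ℓ t} {V : OrderedCommMonoid a} (S : MetricSubsetSpace V m ℓ) →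
    let open OrderedCommMonoid V
        open MetricSubsetSpace S
    in (Or : M) (rOr : Val) → 0# ≤ rOr →
       (T : M → Set t) →
       (∀ Oj → T Oj → (Or ⊑ Oj) × (d Or Oj ≤ rOr)) →
       (Q : M) (rQ : Val) → 0# ≤ rQ →
       rQ + rOr < d Or Q →
       ∀ Oj → T Oj → Oj ⊑ Q → rQ < d Oj Q
lemma1 {V = V} S Or rOr _ T covered Q rQ _ separated Oj Oj∈T Oj⊑Q =
  ≰⇒> inside-query-ball-absurd
  where
    open OrderedCommMonoid V
    open MetricSubsetSpace S
    open StrictOrder V
    open ChainBound S

    inside-query-ball-absurd : ¬ (d Oj Q ≤ rQ)
    inside-query-ball-absurd dOjQ≤rQ with covered Oj Oj∈T
    ... | Or⊑Oj , dOrOj≤rOr = <⇒≱ separated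
      (subst (d Or Q ≤_) (+-comm rOr rQ)
             (⊑-chain-bound Or⊑Oj Oj⊑Q dOrOj≤rOr dOjQ≤rQ))
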